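{- $\operatorname{bdim}(X_k)=\Theta(k)$ for all $k\in\mathbb{Z}^+$.
   Context: $\widehat{X_0}$ is the path $a,b,c$; $\widehat X$ is the graph with vertex set $\{a,b,c\}$ and single edge $ab$. The Cartesian product $G\,\square\,H$ has vertex set $V(G)\times V(H)$, with $(u_1,u_2)\sim(v_1,v_2)$ iff ($u_1=v_1$ and $u_2v_2\in E(H)$) or ($u_2=v_2$ and $u_1v_1\in E(G)$). For $i\ge1$, $\widehat{X_i}=\widehat{X_0}\,\square\,\widehat X\,\square\cdots\square\,\widehat X$ ($i$ copies of $\widehat X$), so vertices are $(i+1)$-tuples over $\{a,b,c\}$. $X_i$ is obtained from $\widehat{X_i}$ by adding, for each $1\le j\le i+1$, a new vertex $s_j$ adjacent to every vertex whose $j$th coordinate is $a$. $d(u,v)$ is graph distance and $d_k(u,v)=\min\{d(u,v),k+1\}$. A function $f:V(G)\to\mathbb{Z}_{\ge0}$ is a resolving broadcast if for any distinct $x,y$ there is $z$ with $f(z)>0$ and $d_{f(z)}(x,z)\ne d_{f(z)}(y,z)$; $\operatorname{bdim}(G)$ is the minimum of $\sum_v f(v)$ over resolving broadcasts. -}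

module Defs where

open import Data.Nat using (ℕ; zero; suc; _≤_; _<_; _⊓_)
open import Data.Fin using (Fin)
open import Data.Vec using (Vec; []; _∷_; lookup)
open import Data.List using (List; []; _∷_; map; concatMap; _++_; allFin)
open import Data.Nat.ListAction using (sum)
open import Data.Product using (Σ; ∃; ∃-syntax; _×_; _,_)
open import Relation.Binary.PropositionalEquality using (_≡_; _≢_)

data Abc : Set where
  a b c : Abc

data PathAdj : Abc → Abc → Set where
  ab : PathAdj a b
  ba : PathAdj b a
  bc : PathAdj b c
  cb : PathAdj c b

data HatAdj : Abc → Abc → Set where
  ab : HatAdj a b
  ba : HatAdj b a

data HatPowAdj : {n : ℕ} → Vec Abc n → Vec Abc n → Set where
  here  : {n : ℕ} {x y : Abc} {xs : Vec Abc n} →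
          HatAdj x y → HatPowAdj (x ∷ xs) (y ∷ xs)
  there : {n : ℕ} {x : Abc} {xs ys : Vec Abc n} →
          HatPowAdj xs ys → HatPowAdj (x ∷ xs) (x ∷ ys)

-- Adjacency in X̂ₖ = X̂₀ □ X̂ □ ⋯ □ X̂ (k copies of X̂); vertices are (k+1)-tuples,
-- the first coordinate being the X̂₀ coordinate.
data TupAdj {k : ℕ} : Vec Abc (suc k) → Vec Abc (suc k) → Set where
  first : {x y : Abc} {xs : Vec Abc k} →
          PathAdj x y → TupAdj (x ∷ xs) (y ∷ xs)
  rest  : {x : Abc} {xs ys : Vec Abc k} →
          HatPowAdj xs ys → TupAdj (x ∷ xs) (x ∷ ys)

-- Vertices of Xₖ: the (k+1)-tuples, and the new vertices s_j for j ∈ Fin (k+1)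
-- (Fin index 0 corresponds to the paper's j = 1, i.e. the first coordinate).
data XV (k : ℕ) : Set where
  tup : Vec Abc (suc k) → XV k
  s   : Fin (suc k) → XV k

data XAdj {k : ℕ} : XV k → XV k → Set where
  tt : {u v : Vec Abc (suc k)} → TupAdj u v → XAdj (tup u) (tup v)
  st : {j : Fin (suc k)} {u : Vec Abc (suc k)} → lookup u j ≡ a → XAdj (s j) (tup u)
  ts : {j : Fin (suc k)} {u : Vec Abc (suc k)} → lookup u j ≡ a → XAdj (tup u) (s j)

data Walk {k : ℕ} : XV k → XV k → ℕ → Set where
  nil  : {u : XV k} → Walk u u 0
  cons : {u w v : XV k} {n : ℕ} → XAdj u w → Walk w v n → Walk u v (suc n)

IsDist : {k : ℕ} → XV k → XV k → ℕ → Set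
IsDist u v n = Walk u v n × ((m : ℕ) → Walk u v m → n ≤ m)

trunc : ℕ → ℕ → ℕ
trunc r d = d ⊓ suc r

Resolving : (k : ℕ) → (XV k → ℕ) → Set
Resolving k f =
  (x y : XV k) → x ≢ y →
  ∃[ z ] (0 < f z × ∃[ dx ] ∃[ dy ]
    (IsDist x z dx × IsDist y z dy × trunc (f z) dx ≢ trunc (f z) dy))

allVecs : (n : ℕ) → List (Vec Abc n)
allVecs zero = [] ∷ []
allVecs (suc n) = concatMap (λ xs → (a ∷ xs) ∷ (b ∷ xs) ∷ (c ∷ xs) ∷ []) (allVecs n)

vertices : (k : ℕ) → List (XV k)
vertices k = map tup (allVecs (suc k)) ++ map s (allFin (suc k))

cost : (k : ℕ) → (XV k → ℕ) → ℕ
cost k f = sum (map f (vertices k))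

-- Upper bound.  Put power 2 on every new vertex s_j (cost 2(k+1) ≤ 4k).
-- From a tuple u, the 2-truncated distance to s_j is 1, 2 or 3 according as
-- u_j is a, b or c; from s_i it is 0 or 2 according as i = j or not.  We
-- prove this by exhibiting a 1-Lipschitz "potential" ρ_j on Xₖ that vanishes
-- at s_j (so it bounds distances to s_j from below) and realising it by
-- explicit walks whenever it is at most 2.  The potentials separate all
-- vertices, so the broadcast is resolving.
--
-- Lower bound (counting).  A vertex z of power r > 0 sees at most r + 2 ≤ 3^r
-- truncated distances, one of power 0 sees nothing.  Recording all truncated
-- distances codes each vertex by an element of Fin (3 ^ cost), injectively
-- if the broadcast is resolving.  As the 3^(k+1) tuples are distinct,
-- 3^(k+1) ≤ 3^cost, i.e. k < cost.
module Submission where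

open import Defs
open import Data.Nat using (ℕ; zero; suc; _≤_; _<_; _⊓_; z≤n; s≤s; _+_; _*_; _^_)
open import Data.Nat.Properties
open import Data.Nat.ListAction using (sum)
open import Data.Nat.ListAction.Properties using (sum-++)
open import Data.Fin using (Fin; toℕ; fromℕ<; combine; remQuot; cast) renaming (zero to fzero; suc to fsuc)
import Data.Fin.Properties as Finₚ
open import Data.Vec using (Vec; []; _∷_; lookup; replicate; _[_]≔_; head; tail)
open import Data.Vec.Properties using (lookup-replicate; lookup∘update; ≡-dec)
open import Data.List using (List; []; _∷_; map; _++_; allFin; length)
open import Data.List.Properties using (map-++; map-∘; length-tabulate)
open import Data.List.Relation.Unary.Any using (Any; here; there; any?; satisfied)
open import Data.List.Membership.Propositional using (_∈_; lose)
open import Data.List.Membership.Propositional.Properties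
  using (∈-map⁺; ∈-++⁺ˡ; ∈-++⁺ʳ; ∈-allFin; ∈-concatMap⁺)
open import Data.Product using (∃-syntax; _×_; _,_; proj₁; proj₂)
open import Data.Sum using (_⊎_; inj₁; inj₂)
open import Data.Empty using (⊥-elim)
open import Relation.Nullary using (Dec; yes; no; ¬_)
open import Relation.Nullary.Decidable using (_×-dec_; _⊎-dec_; map′)
open import Relation.Binary using (DecidableEquality)
open import Relation.Binary.PropositionalEquality
  using (_≡_; _≢_; refl; sym; trans; cong; cong₂; module ≡-Reasoning)

-- Decidability of equality, adjacency and walks in Xₖ.

_≟ᵃ_ : DecidableEquality Abc
a ≟ᵃ a = yes refl
a ≟ᵃ b = no λ ()
a ≟ᵃ c = no λ ()
b ≟ᵃ a = no λ ()
b ≟ᵃ b = yes refl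
b ≟ᵃ c = no λ ()
c ≟ᵃ a = no λ ()
c ≟ᵃ b = no λ ()
c ≟ᵃ c = yes refl

_≟ᵗ_ : ∀ {n} → DecidableEquality (Vec Abc n)
_≟ᵗ_ = ≡-dec _≟ᵃ_

_≟ᵛ_ : ∀ {k} → DecidableEquality (XV k)
tup u ≟ᵛ tup v = map′ (cong tup) (λ { refl → refl }) (u ≟ᵗ v)
tup u ≟ᵛ s j   = no λ ()
s i   ≟ᵛ tup v = no λ ()
s i   ≟ᵛ s j   = map′ (cong s) (λ { refl → refl }) (i Finₚ.≟ j)

pathAdj? : (x y : Abc) → Dec (PathAdj x y)
pathAdj? a a = no λ ()
pathAdj? a b = yes ab
pathAdj? a c = no λ ()
pathAdj? b a = yes ba
pathAdj? b b = no λ ()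
pathAdj? b c = yes bc
pathAdj? c a = no λ ()
pathAdj? c b = yes cb
pathAdj? c c = no λ ()

hatAdj? : (x y : Abc) → Dec (HatAdj x y)
hatAdj? a b = yes ab
hatAdj? b a = yes ba
hatAdj? a a = no λ ()
hatAdj? a c = no λ ()
hatAdj? b b = no λ ()
hatAdj? b c = no λ ()
hatAdj? c a = no λ ()
hatAdj? c b = no λ ()
hatAdj? c c = no λ ()

hatPowAdj? : ∀ {n} (xs ys : Vec Abc n) → Dec (HatPowAdj xs ys)
hatPowAdj? [] [] = no λ ()
hatPowAdj? (x ∷ xs) (y ∷ ys) =
  map′ join split ((hatAdj? x y ×-dec xs ≟ᵗ ys) ⊎-dec (x ≟ᵃ y ×-dec hatPowAdj? xs ys))
  where
  join : (HatAdj x y × xs ≡ ys) ⊎ (x ≡ y × HatPowAdj xs ys) → HatPowAdj (x ∷ xs) (y ∷ ys)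
  join (inj₁ (e , refl)) = here e
  join (inj₂ (refl , e)) = there e
  split : HatPowAdj (x ∷ xs) (y ∷ ys) → (HatAdj x y × xs ≡ ys) ⊎ (x ≡ y × HatPowAdj xs ys)
  split (here e)  = inj₁ (e , refl)
  split (there e) = inj₂ (refl , e)

tupAdj? : ∀ {k} (u v : Vec Abc (suc k)) → Dec (TupAdj u v)
tupAdj? (x ∷ xs) (y ∷ ys) =
  map′ join split ((pathAdj? x y ×-dec xs ≟ᵗ ys) ⊎-dec (x ≟ᵃ y ×-dec hatPowAdj? xs ys))
  where
  join : (PathAdj x y × xs ≡ ys) ⊎ (x ≡ y × HatPowAdj xs ys) → TupAdj (x ∷ xs) (y ∷ ys)
  join (inj₁ (e , refl)) = first e
  join (inj₂ (refl , e)) = rest e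
  split : TupAdj (x ∷ xs) (y ∷ ys) → (PathAdj x y × xs ≡ ys) ⊎ (x ≡ y × HatPowAdj xs ys)
  split (first e) = inj₁ (e , refl)
  split (rest e)  = inj₂ (refl , e)

xAdj? : ∀ {k} (x y : XV k) → Dec (XAdj x y)
xAdj? (tup u) (tup v) = map′ tt (λ { (tt e) → e }) (tupAdj? u v)
xAdj? (tup u) (s j)   = map′ ts (λ { (ts e) → e }) (lookup u j ≟ᵃ a)
xAdj? (s j)   (tup u) = map′ st (λ { (st e) → e }) (lookup u j ≟ᵃ a)
xAdj? (s i)   (s j)   = no λ ()

allVecs-complete : ∀ {n} (v : Vec Abc n) → v ∈ allVecs n
allVecs-complete [] = here refl
allVecs-complete (x ∷ xs) =
  ∈-concatMap⁺ (λ ys → (a ∷ ys) ∷ (b ∷ ys) ∷ (c ∷ ys) ∷ [])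
    (lose (allVecs-complete xs) (pick x))
  where
  pick : (x : Abc) → (x ∷ xs) ∈ (a ∷ xs) ∷ (b ∷ xs) ∷ (c ∷ xs) ∷ []
  pick a = here refl
  pick b = there (here refl)
  pick c = there (there (here refl))

vertices-complete : ∀ {k} (x : XV k) → x ∈ vertices k
vertices-complete (tup u) = ∈-++⁺ˡ (∈-map⁺ tup (allVecs-complete u))
vertices-complete {k} (s j) = ∈-++⁺ʳ (map tup (allVecs (suc k))) (∈-map⁺ s (∈-allFin j))

-- A walk of length n+1 exists iff some vertex adjacent to the start
-- begins a walk of length n; the finite vertex list makes this decidable.
walk? : ∀ {k} (x z : XV k) (n : ℕ) → Dec (Walk x z n)
walk? x z zero = map′ (λ { refl → nil }) (λ { nil → refl }) (x ≟ᵛ z)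
walk? {k} x z (suc n) =
  map′ step (λ { (cons {w = y} e w) → lose (vertices-complete y) (e , w) })
       (any? (λ y → xAdj? x y ×-dec walk? y z n) (vertices k))
  where
  step : Any (λ y → XAdj x y × Walk y z n) (vertices k) → Walk x z (suc n)
  step p with satisfied p
  ... | _ , e , w = cons e w

-- Bounded search: the least n < B satisfying a decidable predicate, or B

least : {Q : ℕ → Set} → ((n : ℕ) → Dec (Q n)) → ℕ → ℕ
least Q? zero = zero
least Q? (suc B) with Q? 0
... | yes _ = 0
... | no _  = suc (least (λ n → Q? (suc n)) B)

least-≤ : {Q : ℕ → Set} (Q? : (n : ℕ) → Dec (Q n)) → ∀ B → least Q? B ≤ B
least-≤ Q? zero = z≤n
least-≤ Q? (suc B) with Q? 0
... | yes _ = z≤n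
... | no _  = s≤s (least-≤ (λ n → Q? (suc n)) B)

least-found : {Q : ℕ → Set} (Q? : (n : ℕ) → Dec (Q n)) → ∀ B n → Q n → n ≤ B → Q (least Q? B)
least-found Q? zero zero q z≤n = q
least-found Q? (suc B) n q n≤B with Q? 0 | n | n≤B
... | yes q₀ | _      | _         = q₀
... | no ¬q₀ | zero   | _         = ⊥-elim (¬q₀ q)
... | no ¬q₀ | suc n′ | s≤s n′≤B = least-found (λ n → Q? (suc n)) B n′ q n′≤B

least-below : {Q : ℕ → Set} (Q? : (n : ℕ) → Dec (Q n)) → ∀ B m → m < least Q? B → ¬ Q m
least-below Q? (suc B) m m< q with Q? 0
least-below Q? (suc B) zero    m<        q | no ¬q₀ = ¬q₀ q
least-below Q? (suc B) (suc m) (s≤s m<) q | no ¬q₀ = least-below (λ n → Q? (suc n)) B m m< q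

least-spec : {Q : ℕ → Set} (Q? : (n : ℕ) → Dec (Q n)) → ∀ B d →
             Q d → (∀ m → m < d → ¬ Q m) → least Q? B ≡ d ⊓ B
least-spec Q? zero d _ _ = sym (⊓-zeroʳ d)
least-spec Q? (suc B) d q minimal with Q? 0 | d
... | yes _  | zero   = refl
... | yes q₀ | suc _  = ⊥-elim (minimal 0 (s≤s z≤n) q₀)
... | no ¬q₀ | zero   = ⊥-elim (¬q₀ q)
... | no _   | suc d′ =
  cong suc (least-spec (λ n → Q? (suc n)) B d′ q (λ m m<d′ → minimal (suc m) (s≤s m<d′)))

_++ʷ_ : ∀ {k} {x y z : XV k} {m n} → Walk x y m → Walk y z n → Walk x z (m + n)
nil      ++ʷ q = q
cons e p ++ʷ q = cons e (p ++ʷ q)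

distance-from-walk : ∀ {k} {x z : XV k} {n} → Walk x z n → ∃[ d ] IsDist x z d
distance-from-walk {x = x} {z} {n} w =
  d , least-found (walk? x z) n n w ≤-refl ,
  λ m wₘ → ≮⇒≥ (λ m<d → least-below (walk? x z) n m m<d wₘ)
  where d = least (walk? x z) n

tdist : ∀ {k} → XV k → XV k → ℕ → ℕ
tdist x z r = least (walk? x z) (suc r)

trunc-tdist : ∀ {k} {x z : XV k} {d} r → IsDist x z d → trunc r d ≡ tdist x z r
trunc-tdist {x = x} {z} {d} r (w , minimal) =
  sym (least-spec (walk? x z) (suc r) d w (λ m m<d wₘ → <⇒≱ m<d (minimal m wₘ)))

lipschitz-walk : ∀ {k} (φ : XV k → ℕ) → (∀ {x y} → XAdj x y → φ x ≤ suc (φ y)) →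
                 ∀ {x z n} → Walk x z n → φ x ≤ n + φ z
lipschitz-walk φ step nil        = ≤-refl
lipschitz-walk φ step (cons e w) = ≤-trans (step e) (s≤s (lipschitz-walk φ step w))

-- Upper bound: the potentials ρ_j.

-- Level of a coordinate value: the 2-truncated distance to s_j from a tuple.
val : Abc → ℕ
val a = 1
val b = 2
val c = 3

val-injective : ∀ x y → val x ≡ val y → x ≡ y
val-injective a a _ = refl
val-injective b b _ = refl
val-injective c c _ = refl
val-injective a b ()
val-injective a c ()
val-injective b a ()
val-injective b c ()
val-injective c a ()
val-injective c b ()

1≤val : ∀ x → 1 ≤ val x
1≤val a = s≤s z≤n
1≤val b = s≤s z≤n
1≤val c = s≤s z≤n

val≤3 : ∀ x → val x ≤ 3
val≤3 a = s≤s z≤n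
val≤3 b = s≤s (s≤s z≤n)
val≤3 c = ≤-refl

pathAdj-val : ∀ {x y} → PathAdj x y → val x ≤ suc (val y)
pathAdj-val ab = s≤s z≤n
pathAdj-val ba = ≤-refl
pathAdj-val bc = s≤s (s≤s z≤n)
pathAdj-val cb = ≤-refl

hatAdj⇒pathAdj : ∀ {x y} → HatAdj x y → PathAdj x y
hatAdj⇒pathAdj ab = ab
hatAdj⇒pathAdj ba = ba

hatPowAdj-val : ∀ {n} {u v : Vec Abc n} → HatPowAdj u v → ∀ j → val (lookup u j) ≤ suc (val (lookup v j))
hatPowAdj-val (here e)  fzero    = pathAdj-val (hatAdj⇒pathAdj e)
hatPowAdj-val (here e)  (fsuc j) = n≤1+n _
hatPowAdj-val (there e) fzero    = n≤1+n _
hatPowAdj-val (there e) (fsuc j) = hatPowAdj-val e j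

tupAdj-val : ∀ {k} {u v : Vec Abc (suc k)} → TupAdj u v → ∀ j → val (lookup u j) ≤ suc (val (lookup v j))
tupAdj-val (first e) fzero    = pathAdj-val e
tupAdj-val (first e) (fsuc j) = n≤1+n _
tupAdj-val (rest e)  fzero    = n≤1+n _
tupAdj-val (rest e)  (fsuc j) = hatPowAdj-val e j

sLevel : ∀ {k} {i j : Fin (suc k)} → Dec (i ≡ j) → ℕ
sLevel (yes _) = 0
sLevel (no _)  = 2

sLevel≤2 : ∀ {k} {i j : Fin (suc k)} (i≟j : Dec (i ≡ j)) → sLevel i≟j ≤ 2
sLevel≤2 (yes _) = z≤n
sLevel≤2 (no _)  = ≤-refl

-- ρ j x : the claimed 2-truncated distance from x to s_j.
ρ : ∀ {k} → Fin (suc k) → XV k → ℕ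
ρ j (tup u) = val (lookup u j)
ρ j (s i)   = sLevel (i Finₚ.≟ j)

ρ-target : ∀ {k} (j : Fin (suc k)) → ρ j (s j) ≡ 0
ρ-target j with j Finₚ.≟ j
... | yes _ = refl
... | no j≢j = ⊥-elim (j≢j refl)

ρ-other : ∀ {k} {i j : Fin (suc k)} → i ≢ j → ρ j (s i) ≡ 2
ρ-other {i = i} {j} i≢j with i Finₚ.≟ j
... | yes i≡j = ⊥-elim (i≢j i≡j)
... | no _    = refl

ρ≤3 : ∀ {k} (j : Fin (suc k)) x → ρ j x ≤ 3
ρ≤3 j (tup u) = val≤3 (lookup u j)
ρ≤3 j (s i) = ≤-trans (sLevel≤2 (i Finₚ.≟ j)) (n≤1+n 2)

ρ-step : ∀ {k} (j : Fin (suc k)) {x y : XV k} → XAdj x y → ρ j x ≤ suc (ρ j y)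
ρ-step j (tt e) = tupAdj-val e j
ρ-step j (st {i} {u} _) = ≤-trans (sLevel≤2 (i Finₚ.≟ j)) (s≤s (1≤val (lookup u j)))
ρ-step j (ts {i} {u} uᵢ≡a) with i Finₚ.≟ j
... | yes refl = ≤-reflexive (cong val uᵢ≡a)
... | no _     = val≤3 (lookup u j)

ρ≤dist : ∀ {k} (j : Fin (suc k)) {x : XV k} {d} → IsDist x (s j) d → ρ j x ≤ d
ρ≤dist j {x} {d} (w , _) = begin
  ρ j x           ≤⟨ lipschitz-walk (ρ j) (ρ-step j) w ⟩
  d + ρ j (s j)   ≡⟨ cong (d +_) (ρ-target j) ⟩
  d + 0           ≡⟨ +-identityʳ d ⟩
  d               ∎
  where open ≤-Reasoning

-- Any two new vertices are joined through the all-a tuple.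
ss-walk : ∀ {k} (i j : Fin (suc k)) → Walk (s i) (s j) 2
ss-walk {k} i j =
  cons (st {u = replicate (suc k) a} (lookup-replicate i a)) (cons (ts (lookup-replicate {n = suc k} j a)) nil)

to-head-a : ∀ {k} (u : Vec Abc (suc k)) → ∃[ n ] Walk (tup u) (tup (u [ fzero ]≔ a)) n
to-head-a (a ∷ xs) = 0 , nil
to-head-a (b ∷ xs) = 1 , cons (tt (first ba)) nil
to-head-a (c ∷ xs) = 2 , cons (tt (first cb)) (cons (tt (first ba)) nil)

-- Xₖ is connected enough: every vertex reaches s_j (via s₀).
walk-to-s : ∀ {k} (x : XV k) (j : Fin (suc k)) → ∃[ n ] Walk x (s j) n
walk-to-s (tup u) j =
  let (n , w) = to-head-a u in
  n + 3 , (w ++ʷ cons (ts (lookup∘update fzero u a)) (ss-walk fzero j))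
walk-to-s (s i) j = 2 , ss-walk i j

hatPowAdj-b→a : ∀ {n} (u : Vec Abc n) j → lookup u j ≡ b → HatPowAdj u (u [ j ]≔ a)
hatPowAdj-b→a (b ∷ xs) fzero    refl = here ba
hatPowAdj-b→a (x ∷ xs) (fsuc j) uⱼ≡b = there (hatPowAdj-b→a xs j uⱼ≡b)

tupAdj-b→a : ∀ {k} (u : Vec Abc (suc k)) j → lookup u j ≡ b → TupAdj u (u [ j ]≔ a)
tupAdj-b→a (b ∷ xs) fzero    refl = first ba
tupAdj-b→a (x ∷ xs) (fsuc j) uⱼ≡b = rest (hatPowAdj-b→a xs j uⱼ≡b)

ρ-walk-exists : ∀ {k} (j : Fin (suc k)) (x : XV k) → ρ j x ≤ 2 → Walk x (s j) (ρ j x)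
ρ-walk-exists j (tup u) ρ≤2 with lookup u j in uⱼ
... | a = cons (ts uⱼ) nil
... | b = cons (tt (tupAdj-b→a u j uⱼ)) (cons (ts (lookup∘update j u a)) nil)
... | c = ⊥-elim (<⇒≱ ≤-refl ρ≤2)
ρ-walk-exists j (s i) _ with i Finₚ.≟ j
... | yes refl = nil
... | no _     = ss-walk i j

trunc-dist-s : ∀ {k} (j : Fin (suc k)) (x : XV k) {d} → IsDist x (s j) d → trunc 2 d ≡ ρ j x
trunc-dist-s j x {d} D@(_ , minimal) with ρ j x ≤? 2
... | yes ρ≤2 =
  trans (cong (_⊓ 3) (≤-antisym (minimal (ρ j x) (ρ-walk-exists j x ρ≤2)) (ρ≤dist j D)))
        (m≤n⇒m⊓n≡m (ρ≤3 j x))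
... | no ρ≰2 =
  let ρ≡3 = ≤-antisym (ρ≤3 j x) (≰⇒> ρ≰2) in
  trans (m≥n⇒m⊓n≡n (≤-trans (≤-reflexive (sym ρ≡3)) (ρ≤dist j D))) (sym ρ≡3)

differing-coordinate : ∀ {n} (u v : Vec Abc n) → u ≢ v → ∃[ j ] lookup u j ≢ lookup v j
differing-coordinate [] [] u≢v = ⊥-elim (u≢v refl)
differing-coordinate (x ∷ xs) (y ∷ ys) u≢v with x ≟ᵃ y
... | no x≢y = fzero , x≢y
... | yes refl =
  let (j , d) = differing-coordinate xs ys (λ e → u≢v (cong (x ∷_) e)) in fsuc j , d

ρ-separates : ∀ {k} (x y : XV k) → x ≢ y → ∃[ j ] ρ j x ≢ ρ j y
ρ-separates (tup u) (tup v) u≢v =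
  let (j , d) = differing-coordinate u v (λ e → u≢v (cong tup e)) in
  j , λ e → d (val-injective _ _ e)
ρ-separates (tup u) (s i) _ =
  i , λ e → <⇒≢ (1≤val (lookup u i)) (sym (trans e (ρ-target i)))
ρ-separates (s i) (tup u) _ =
  i , λ e → <⇒≢ (1≤val (lookup u i)) (sym (trans (sym e) (ρ-target i)))
ρ-separates (s i) (s i′) i≢i′ =
  i , λ e → 0≢1+n (trans (sym (ρ-target i)) (trans e (ρ-other (λ i′≡i → i≢i′ (cong s (sym i′≡i))))))

beacons : ∀ {k} → XV k → ℕ
beacons (tup _) = 0
beacons (s _)   = 2

beacons-resolving : ∀ k → Resolving k beacons
beacons-resolving k x y x≢y =
  let (j , ρ≢) = ρ-separates x y x≢y
      (dx , Dx) = distance-from-walk (proj₂ (walk-to-s x j))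
      (dy , Dy) = distance-from-walk (proj₂ (walk-to-s y j))
  in s j , s≤s z≤n , dx , dy , Dx , Dy ,
     λ e → ρ≢ (trans (sym (trunc-dist-s j x Dx)) (trans e (trunc-dist-s j y Dy)))

sum-map-const : ∀ {A : Set} (m : ℕ) (xs : List A) → sum (map (λ _ → m) xs) ≡ m * length xs
sum-map-const m []       = sym (*-zeroʳ m)
sum-map-const m (x ∷ xs) = trans (cong (m +_) (sum-map-const m xs)) (sym (*-suc m (length xs)))

beacons-cost : ∀ k → cost k beacons ≡ 2 * suc k
beacons-cost k = begin
  sum (map beacons (map tup tuples ++ map s indices))
    ≡⟨ cong sum (map-++ beacons (map tup tuples) (map s indices)) ⟩
  sum (map beacons (map tup tuples) ++ map beacons (map s indices))
    ≡⟨ sum-++ (map beacons (map tup tuples)) (map beacons (map s indices)) ⟩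
  sum (map beacons (map tup tuples)) + sum (map beacons (map s indices))
    ≡⟨ cong₂ _+_ (cong sum (sym (map-∘ {g = beacons} {f = tup} tuples)))
                    (cong sum (sym (map-∘ {g = beacons} {f = s} indices))) ⟩
  sum (map (λ _ → 0) tuples) + sum (map (λ _ → 2) indices)
    ≡⟨ cong₂ _+_ (sum-map-const 0 tuples) (sum-map-const 2 indices) ⟩
  0 + 2 * length indices
    ≡⟨ cong (2 *_) (length-tabulate {n = suc k} (λ i → i)) ⟩
  2 * suc k ∎
  where
  open ≡-Reasoning
  tuples : List (Vec Abc (suc k))
  tuples = allVecs (suc k)
  indices : List (Fin (suc k))
  indices = allFin (suc k)

beacons-cost-≤ : ∀ k → 1 ≤ k → cost k beacons ≤ 4 * k
beacons-cost-≤ k 1≤k = begin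
  cost k beacons  ≡⟨ beacons-cost k ⟩
  2 * (1 + k)     ≤⟨ *-monoʳ-≤ 2 (+-monoˡ-≤ k 1≤k) ⟩
  2 * (k + k)     ≡⟨ cong (λ m → 2 * (k + m)) (sym (+-identityʳ k)) ⟩
  2 * (2 * k)     ≡⟨ sym (*-assoc 2 2 k) ⟩
  4 * k           ∎
  where open ≤-Reasoning

-- Lower bound: coding vertices by truncated distances.

-- There are r + 3 ≤ 3^(r+1) possible (r+1)-truncated distances.
r+3≤3^[1+r] : ∀ r → 3 + r ≤ 3 ^ suc r
r+3≤3^[1+r] zero    = ≤-refl
r+3≤3^[1+r] (suc r) = begin
  4 + r            ≤⟨ s≤s (r+3≤3^[1+r] r) ⟩
  1 + 3 ^ suc r    ≤⟨ m<m*n (3 ^ suc r) 3 {{m^n≢0 3 (suc r)}} (s≤s (s≤s z≤n)) ⟩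
  3 ^ suc r * 3    ≡⟨ *-comm (3 ^ suc r) 3 ⟩
  3 ^ suc (suc r)  ∎
  where open ≤-Reasoning

-- What a vertex z of power r sees of x: its r-truncated distance, one of
-- at most r + 2 ≤ 3^r values (nothing at all if r = 0).
probe : ∀ {k} (r : ℕ) → XV k → XV k → Fin (3 ^ r)
probe zero    x z = fzero
probe (suc r) x z =
  fromℕ< (≤-trans (s≤s (least-≤ (walk? x z) (suc (suc r)))) (r+3≤3^[1+r] r))

probe-tdist : ∀ {k} r (x y z : XV k) → 0 < r → probe r x z ≡ probe r y z → tdist x z r ≡ tdist y z r
probe-tdist (suc r) x y z _ e = begin
  tdist x z (suc r)            ≡⟨ sym (Finₚ.toℕ-fromℕ< _) ⟩
  toℕ (probe (suc r) x z)      ≡⟨ cong toℕ e ⟩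
  toℕ (probe (suc r) y z)      ≡⟨ Finₚ.toℕ-fromℕ< _ ⟩
  tdist y z (suc r)            ∎
  where open ≡-Reasoning

cast-injective : ∀ {m n} (eq : m ≡ n) {i j : Fin m} → cast eq i ≡ cast eq j → i ≡ j
cast-injective eq {i} {j} e = begin
  i                          ≡⟨ sym (Finₚ.cast-involutive (sym eq) eq i) ⟩
  cast (sym eq) (cast eq i)  ≡⟨ cong (cast (sym eq)) e ⟩
  cast (sym eq) (cast eq j)  ≡⟨ Finₚ.cast-involutive (sym eq) eq j ⟩
  j                          ∎
  where open ≡-Reasoning

-- The joint view of x from the vertices zs, packed into Fin (3 ^ Σ f).
code : ∀ {k} (f : XV k → ℕ) (zs : List (XV k)) → XV k → Fin (3 ^ sum (map f zs))
code f []       x = fzero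
code f (z ∷ zs) x =
  cast (sym (^-distribˡ-+-* 3 (f z) (sum (map f zs)))) (combine (probe (f z) x z) (code f zs x))

code-cons-injective : ∀ {k} (f : XV k → ℕ) z zs {x y : XV k} → code f (z ∷ zs) x ≡ code f (z ∷ zs) y →
                      probe (f z) x z ≡ probe (f z) y z × code f zs x ≡ code f zs y
code-cons-injective f z zs {x} {y} e =
  Finₚ.combine-injective (probe (f z) x z) (code f zs x) (probe (f z) y z) (code f zs y)
    (cast-injective (sym (^-distribˡ-+-* 3 (f z) (sum (map f zs)))) e)

code-probe : ∀ {k} (f : XV k → ℕ) zs {x y z : XV k} → code f zs x ≡ code f zs y → z ∈ zs →
             probe (f z) x z ≡ probe (f z) y z
code-probe f (z ∷ zs) e (here refl)  = proj₁ (code-cons-injective f z zs e)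
code-probe f (z ∷ zs) e (there z′∈) = code-probe f zs (proj₂ (code-cons-injective f z zs e)) z′∈

code-injective : ∀ {k} (f : XV k → ℕ) → Resolving k f → ∀ x y →
                 code f (vertices k) x ≡ code f (vertices k) y → x ≡ y
code-injective {k} f R x y e with x ≟ᵛ y
... | yes x≡y = x≡y
... | no x≢y =
  let (z , 0<fz , dx , dy , Dx , Dy , trunc≢) = R x y x≢y in
  ⊥-elim (trunc≢ (begin
    trunc (f z) dx     ≡⟨ trunc-tdist (f z) Dx ⟩
    tdist x z (f z)    ≡⟨ probe-tdist (f z) x y z 0<fz (code-probe f (vertices k) e (vertices-complete z)) ⟩
    tdist y z (f z)    ≡⟨ sym (trunc-tdist (f z) Dy) ⟩
    trunc (f z) dy     ∎))
  where open ≡-Reasoning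

tup-injective : ∀ {k} {u v : Vec Abc (suc k)} → tup {k} u ≡ tup v → u ≡ v
tup-injective refl = refl

digit : Fin 3 → Abc
digit fzero               = a
digit (fsuc fzero)        = b
digit (fsuc (fsuc fzero)) = c

digit-injective : ∀ i j → digit i ≡ digit j → i ≡ j
digit-injective fzero               fzero               _ = refl
digit-injective (fsuc fzero)        (fsuc fzero)        _ = refl
digit-injective (fsuc (fsuc fzero)) (fsuc (fsuc fzero)) _ = refl
digit-injective fzero               (fsuc fzero)        ()
digit-injective fzero               (fsuc (fsuc fzero)) ()
digit-injective (fsuc fzero)        fzero               ()
digit-injective (fsuc fzero)        (fsuc (fsuc fzero)) ()
digit-injective (fsuc (fsuc fzero)) fzero               ()
digit-injective (fsuc (fsuc fzero)) (fsuc fzero)        ()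

word : ∀ n → Fin (3 ^ n) → Vec Abc n
word zero    _ = []
word (suc n) i = let (q , r) = remQuot {3} (3 ^ n) i in digit q ∷ word n r

word-injective : ∀ n {i j} → word n i ≡ word n j → i ≡ j
word-injective zero    {fzero} {fzero} _ = refl
word-injective (suc n) {i} {j} e = begin
  i                                    ≡⟨ sym (Finₚ.combine-remQuot {3} (3 ^ n) i) ⟩
  combine (proj₁ (rq i)) (proj₂ (rq i)) ≡⟨ cong₂ combine (digit-injective _ _ (cong head e))
                                                        (word-injective n (cong tail e)) ⟩
  combine (proj₁ (rq j)) (proj₂ (rq j)) ≡⟨ Finₚ.combine-remQuot {3} (3 ^ n) j ⟩
  j                                    ∎
  where
  open ≡-Reasoning
  rq : Fin (3 ^ suc n) → Fin 3 × Fin (3 ^ n)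
  rq = remQuot {3} (3 ^ n)

-- The 3^(k+1) tuples receive distinct codes in Fin (3 ^ cost), so k < cost.
resolving-cost : ∀ k (f : XV k → ℕ) → Resolving k f → suc k ≤ cost k f
resolving-cost k f R = ≮⇒≥ λ cost<1+k → <⇒≱ (^-monoʳ-< 3 (s≤s (s≤s z≤n)) cost<1+k) 3^[1+k]≤3^cost
  where
  3^[1+k]≤3^cost : 3 ^ suc k ≤ 3 ^ cost k f
  3^[1+k]≤3^cost = Finₚ.injective⇒≤ λ e →
    word-injective (suc k) (tup-injective (code-injective f R _ _ e))

lemma5p3 : ∃[ A ] ∃[ B ] ((k : ℕ) → 1 ≤ k →
             (∃[ f ] (Resolving k f × cost k f ≤ B * k))
             × ((f : XV k → ℕ) → Resolving k f → k ≤ A * cost k f))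
lemma5p3 = 1 , 4 , λ k 1≤k →
  (beacons , beacons-resolving k , beacons-cost-≤ k 1≤k) ,
  λ f R → ≤-trans (n≤1+n k) (≤-trans (resolving-cost k f R) (≤-reflexive (sym (*-identityˡ (cost k f)))))
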